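{- For $n\ge0$ let $P_n$ be the directed path on $n$ vertices ($P_0$ having no vertices). Then $$\sum_{n=0}^{\infty}\frac{\sigma^{ns}(P_n)}{n!}X^n=\frac12\big(1+\exp(2X)I_0(2X)\big),$$ where $I_0$ is the modified Bessel function of the first kind of order $0$.
   Context: The directed path $P_n$ has vertices $v_1,\dots,v_n$ and arcs $(v_1,v_2),\dots,(v_{n-1},v_n)$. For $i\in\mathbb N$, a non-strict disposition of size $i$ of a digraph $(V,A)$ is a map $f:V\to\{1,\dots,i\}$ such that $f(v_1)\ge f(v_2)$ whenever $(v_1,v_2)\in A$; $\sigma^{ns}_i$ denotes the number of such maps. For a digraph of order $n$, $\sigma^{ns}=\sigma^{ns}_n$ (the non-strict counter), with $\sigma^{ns}(P_0)=1$. $I_0(x)=\sum_{s\ge0}\frac{(x/2)^{2s}}{(s!)^2}$. -}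

module Defs where

open import Data.Nat as ℕ using (ℕ; zero; suc; _∸_; _!; _≥_)
open import Data.Nat.Properties using (_!≢0)
open import Data.Nat.Divisibility using (_∣?_)
open import Data.Nat.DivMod using (_/_)
open import Data.Integer using (+_)
open import Data.Rational as ℚ using (ℚ; 0ℚ; 1ℚ; _+_; _*_; ½)
open import Data.Fin using (Fin; toℕ; inject₁) renaming (suc to fsuc)
open import Data.Fin.Properties using (all?)
open import Data.Vec using (Vec; []; _∷_; lookup)
open import Data.List using (List; []; _∷_; map; concatMap; upTo; length; filter; allFin; foldr)
open import Data.List.Relation.Unary.All using (All)
open import Data.List.Relation.Unary.All.Properties using ()
import Data.List.Relation.Unary.All as All
open import Data.Product using (_×_; _,_; proj₁; proj₂)
open import Relation.Nullary using (Dec; yes; no)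
open import Relation.Nullary.Decidable using (⌊_⌋)
open import Data.Bool using (if_then_else_)

record Digraph : Set where
  field
    order : ℕ
    arcs  : List (Fin order × Fin order)
open Digraph public

-- all maps Fin n → Fin i, represented as vectors
allVecs : (i n : ℕ) → List (Vec (Fin i) n)
allVecs i zero    = [] ∷ []
allVecs i (suc n) = concatMap (λ a → map (a ∷_) (allVecs i n)) (allFin i)

IsNonStrictDisposition : (G : Digraph) (i : ℕ) → Vec (Fin i) (order G) → Set
IsNonStrictDisposition G i f =
  All (λ uv → toℕ (lookup f (proj₁ uv)) ≥ toℕ (lookup f (proj₂ uv))) (arcs G)

isNonStrictDisposition? : (G : Digraph) (i : ℕ) (f : Vec (Fin i) (order G)) →
  Dec (IsNonStrictDisposition G i f)
isNonStrictDisposition? G i f =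
  All.all? (λ uv → toℕ (lookup f (proj₂ uv)) ℕ.≤? toℕ (lookup f (proj₁ uv))) (arcs G)

σnsᵢ : (i : ℕ) → Digraph → ℕ
σnsᵢ i G = length (filter (isNonStrictDisposition? G i) (allVecs i (order G)))

σns : Digraph → ℕ
σns G = σnsᵢ (order G) G

pathArcs : (n : ℕ) → List (Fin n × Fin n)
pathArcs zero    = []
pathArcs (suc m) = map (λ j → inject₁ j , fsuc j) (allFin m)

P : ℕ → Digraph
P n = record { order = n ; arcs = pathArcs n }

FPS : Set
FPS = ℕ → ℚ

1/! : ℕ → ℚ
1/! n = (+ 1) ℚ./ (n !) where instance _ = n !≢0

sumTo : ℕ → (ℕ → ℚ) → ℚ
sumTo n f = foldr (λ k acc → f k + acc) 0ℚ (upTo (suc n))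

_⊛_ : FPS → FPS → FPS
(f ⊛ g) n = sumTo n (λ k → f k * g (n ∸ k))

_⊕_ : FPS → FPS → FPS
(f ⊕ g) n = f n + g n

_·_ : ℚ → FPS → FPS
(c · f) n = c * f n

const : ℚ → FPS
const c zero    = c
const c (suc _) = 0ℚ

pow : ℚ → ℕ → ℚ
pow c zero = 1ℚ
pow c (suc n) = c * pow c n

-- substitution X ↦ c X
scaleArg : ℚ → FPS → FPS
scaleArg c f n = (pow c n) * f n

expS : FPS
expS n = 1/! n

-- I₀(x) = Σ_s (x/2)^{2s} / (s!)²
I₀S : FPS
I₀S n = if ⌊ 2 ∣? n ⌋ then (pow ½ n) * (1/! (n / 2) * 1/! (n / 2)) else 0ℚ

two : ℚ
two = (+ 2) ℚ./ 1

lhsS : FPS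
lhsS n = ((+ (σns (P n))) ℚ./ 1) * 1/! n

rhsS : FPS
rhsS = ½ · (const 1ℚ ⊕ (scaleArg two expS ⊛ scaleArg two I₀S))

{-# OPTIONS --safe #-}
module Submission where

-- A non-strict disposition of P n of size i is a non-increasing word of length n over i letters;
-- sorting such words by their first letter and applying the hockey-stick identity gives
-- σ^{ns}_i(P n) = C(n + i - 1, n), so 2 σ^{ns}(P n) = C(2n, n) for n ≥ 1.
-- On the other side, n! times the n-th coefficient of exp(2X) I₀(2X) is
-- Σₛ n! 2ⁿ⁻²ˢ / ((n - 2s)! s! s!), the constant term of (X + 2 + X⁻¹)ⁿ = X⁻ⁿ (1 + X)²ⁿ,
-- which is again C(2n, n).
-- The summand ½ · 1 on the right repairs n = 0, where σ^{ns}(P 0) = 1 = C(0, 0).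

open import Defs
open import Relation.Binary.PropositionalEquality using (_≡_)
open import Data.Nat using (ℕ)

open import Algebra.Bundles using (CommutativeSemiring; CommutativeRing)
open import Data.Bool using (true; false; if_then_else_)
open import Data.List using (List; []; _∷_; foldr; applyUpTo)
open import Data.Nat as ℕ using (zero; suc; _∸_; _≤_; _<_; _≤′_; ≤′-refl; ≤′-step; z≤n; s≤s; _!; _/_)
import Data.Nat.DivMod as ℕ
import Data.Nat.Properties as ℕ
open import Data.Nat.Combinatorics using (_C_; nCk+nC[k+1]≡[n+1]C[k+1]; nCk≡nC[n∸k]; nCn≡1)
open import Data.Nat.Divisibility using (_∣?_; divides; m∣m*n)
open import Data.Nat.Tactic.RingSolver using (solve-∀)
open import Function using (_∘_)
import Relation.Binary.PropositionalEquality as ≡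
open import Relation.Nullary using (yes; no; does; contradiction)
open import Relation.Nullary.Decidable using (⌊_⌋; dec-true; dec-false)

module FiniteSum {c ℓ} (R : CommutativeSemiring c ℓ) where

  open CommutativeSemiring R
  open import Relation.Binary.Reasoning.Setoid setoid
  open import Algebra.Properties.CommutativeSemigroup +-commutativeSemigroup using (x∙yz≈y∙xz)

  Σ< : ℕ → (ℕ → Carrier) → Carrier
  Σ< zero    f = 0#
  Σ< (suc n) f = f 0 + Σ< n (f ∘ suc)

  Σ<-cong : ∀ n {f g} → (∀ k → k < n → f k ≈ g k) → Σ< n f ≈ Σ< n g
  Σ<-cong zero    f≈g = refl
  Σ<-cong (suc n) f≈g = +-cong (f≈g 0 (s≤s z≤n)) (Σ<-cong n (λ k k<n → f≈g (suc k) (s≤s k<n)))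

  Σ<-suc : ∀ n f → Σ< (suc n) f ≈ Σ< n f + f n
  Σ<-suc zero    f = +-comm (f 0) 0#
  Σ<-suc (suc n) f = begin
    f 0 + Σ< (suc n) (f ∘ suc)         ≈⟨ +-congˡ (Σ<-suc n (f ∘ suc)) ⟩
    f 0 + (Σ< n (f ∘ suc) + f (suc n)) ≈⟨ +-assoc (f 0) _ _ ⟨
    Σ< (suc n) f + f (suc n)           ∎

  Σ<-distrib-+ : ∀ n f g → Σ< n (λ k → f k + g k) ≈ Σ< n f + Σ< n g
  Σ<-distrib-+ zero    f g = sym (+-identityˡ 0#)
  Σ<-distrib-+ (suc n) f g = begin
    (f 0 + g 0) + Σ< n (λ k → f (suc k) + g (suc k)) ≈⟨ +-congˡ (Σ<-distrib-+ n (f ∘ suc) (g ∘ suc)) ⟩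
    (f 0 + g 0) + (Σ< n (f ∘ suc) + Σ< n (g ∘ suc)) ≈⟨ +-assoc (f 0) (g 0) _ ⟩
    f 0 + (g 0 + (Σ< n (f ∘ suc) + Σ< n (g ∘ suc))) ≈⟨ +-congˡ (x∙yz≈y∙xz (g 0) _ _) ⟩
    f 0 + (Σ< n (f ∘ suc) + (g 0 + Σ< n (g ∘ suc))) ≈⟨ +-assoc (f 0) _ _ ⟨
    Σ< (suc n) f + Σ< (suc n) g                      ∎

  *-distribˡ-Σ< : ∀ n x f → x * Σ< n f ≈ Σ< n (λ k → x * f k)
  *-distribˡ-Σ< zero    x f = zeroʳ x
  *-distribˡ-Σ< (suc n) x f = trans (distribˡ x (f 0) _) (+-congˡ (*-distribˡ-Σ< n x (f ∘ suc)))

  *-distribʳ-Σ< : ∀ n f x → Σ< n f * x ≈ Σ< n (λ k → f k * x)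
  *-distribʳ-Σ< zero    f x = zeroˡ x
  *-distribʳ-Σ< (suc n) f x = trans (distribʳ x (f 0) _) (+-congˡ (*-distribʳ-Σ< n (f ∘ suc) x))

  Σ<-reverse : ∀ n f → Σ< n f ≈ Σ< n (λ k → f (n ∸ suc k))
  Σ<-reverse zero    f = refl
  Σ<-reverse (suc n) f = begin
    f 0 + Σ< n (f ∘ suc)                   ≈⟨ +-congˡ (Σ<-reverse n (f ∘ suc)) ⟩
    f 0 + Σ< n (λ k → f (suc (n ∸ suc k))) ≈⟨ +-congˡ (Σ<-cong n (λ k k<n → reflexive (≡.cong f (≡.sym (ℕ.+-∸-assoc 1 k<n))))) ⟩
    f 0 + Σ< n (λ k → f (n ∸ k))           ≈⟨ +-comm (f 0) _ ⟩
    Σ< n (λ k → f (n ∸ k)) + f 0           ≈⟨ +-congˡ (reflexive (≡.cong f (ℕ.n∸n≡0 n))) ⟨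
    Σ< n (λ k → f (n ∸ k)) + f (n ∸ n)     ≈⟨ Σ<-suc n (λ k → f (n ∸ k)) ⟨
    Σ< (suc n) (λ k → f (suc n ∸ suc k))   ∎

  Σ<-vanishing : ∀ {m n} f → m ≤ n → (∀ k → m ≤ k → f k ≈ 0#) → Σ< n f ≈ Σ< m f
  Σ<-vanishing {m} f m≤n f≈0 = go (ℕ.≤⇒≤′ m≤n)
    where
    go : ∀ {n} → m ≤′ n → Σ< n f ≈ Σ< m f
    go ≤′-refl            = refl
    go (≤′-step {n} m≤′n) = begin
      Σ< (suc n) f ≈⟨ Σ<-suc n f ⟩
      Σ< n f + f n ≈⟨ +-cong (go m≤′n) (f≈0 n (ℕ.≤′⇒≤ m≤′n)) ⟩
      Σ< m f + 0#  ≈⟨ +-identityʳ _ ⟩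
      Σ< m f       ∎

  Σ<-pairs : ∀ n f → Σ< (2 ℕ.* n) f ≈ Σ< n (λ k → f (2 ℕ.* k) + f (suc (2 ℕ.* k)))
  Σ<-pairs zero    f = refl
  Σ<-pairs (suc n) f = begin
    Σ< (2 ℕ.* suc n) f                                              ≡⟨ ≡.cong (λ m → Σ< m f) (ℕ.*-suc 2 n) ⟩
    f 0 + (f 1 + Σ< (2 ℕ.* n) (f ∘ suc ∘ suc))                      ≈⟨ +-assoc (f 0) (f 1) _ ⟨
    (f 0 + f 1) + Σ< (2 ℕ.* n) (f ∘ suc ∘ suc)                      ≈⟨ +-congˡ (Σ<-pairs n (f ∘ suc ∘ suc)) ⟩
    (f 0 + f 1) + Σ< n (λ k → f (2 ℕ.+ 2 ℕ.* k) + f (3 ℕ.+ 2 ℕ.* k))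
      ≈⟨ +-congˡ (Σ<-cong n (λ k _ → reflexive (≡.cong (λ m → f m + f (suc m)) (ℕ.*-suc 2 k)))) ⟨
    Σ< (suc n) (λ k → f (2 ℕ.* k) + f (suc (2 ℕ.* k)))              ∎

  Σ<-evens : ∀ n f → (∀ s → n < 2 ℕ.* s → f s ≈ 0#) →
             Σ< (suc n) (λ j → if ⌊ 2 ∣? j ⌋ then f (j / 2) else 0#) ≈ Σ< (suc n) f
  Σ<-evens n f f≈0 = begin
    Σ< (suc n) evens                                             ≈⟨ Σ<-vanishing evens (ℕ.m≤n*m (suc n) 2) evens≈0 ⟨
    Σ< (2 ℕ.* suc n) evens                                       ≈⟨ Σ<-pairs (suc n) evens ⟩
    Σ< (suc n) (λ s → evens (2 ℕ.* s) + evens (suc (2 ℕ.* s)))   ≈⟨ Σ<-cong (suc n) (λ s _ → +-cong (evens-even s) (evens-odd s)) ⟩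
    Σ< (suc n) (λ s → f s + 0#)                                  ≈⟨ Σ<-cong (suc n) (λ s _ → +-identityʳ (f s)) ⟩
    Σ< (suc n) f                                                 ∎
    where
    evens : ℕ → Carrier
    evens j = if ⌊ 2 ∣? j ⌋ then f (j / 2) else 0#

    evens≈0 : ∀ j → suc n ≤ j → evens j ≈ 0#
    evens≈0 j n<j with 2 ∣? j
    ... | yes 2∣j = f≈0 (j / 2) (ℕ.≤-trans n<j (ℕ.≤-reflexive (≡.sym (ℕ.m*[n/m]≡n 2∣j))))
    ... | no  _   = refl

    evens-even : ∀ s → evens (2 ℕ.* s) ≈ f s
    evens-even s with 2 ∣? (2 ℕ.* s)
    ... | yes _    = reflexive (≡.cong f (≡.trans (≡.cong (_/ 2) (ℕ.*-comm 2 s)) (ℕ.m*n/n≡m s 2)))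
    ... | no  2∤2s = contradiction (m∣m*n s) 2∤2s

    evens-odd : ∀ s → evens (suc (2 ℕ.* s)) ≈ 0#
    evens-odd s with 2 ∣? suc (2 ℕ.* s)
    ... | yes (divides q 1+2s≡q*2) = contradiction (≡.trans (ℕ.*-comm 2 q) (≡.sym 1+2s≡q*2)) (ℕ.even≢odd q s)
    ... | no  _                    = refl

  foldr-applyUpTo : ∀ (f : ℕ → Carrier) g n → foldr (λ k acc → f k + acc) 0# (applyUpTo g n) ≈ Σ< n (f ∘ g)
  foldr-applyUpTo f g zero    = refl
  foldr-applyUpTo f g (suc n) = +-congˡ (foldr-applyUpTo f (g ∘ suc) n)

open import Relation.Binary.PropositionalEquality using (refl; sym; trans; cong; cong₂; subst; module ≡-Reasoning)

module ℕΣ = FiniteSum ℕ.+-*-commutativeSemiring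

module Binomial where

  open import Data.Nat using (_+_; _*_)
  open ℕΣ using (Σ<; Σ<-suc)
  open ≡-Reasoning

  C-pascal² : ∀ n k → suc (suc n) C suc (suc k) ≡ n C k + 2 * (n C suc k) + n C suc (suc k)
  C-pascal² n k = begin
    suc (suc n) C suc (suc k)                            ≡⟨ nCk+nC[k+1]≡[n+1]C[k+1] (suc n) (suc k) ⟨
    suc n C suc k + suc n C suc (suc k)                  ≡⟨ cong₂ _+_ (nCk+nC[k+1]≡[n+1]C[k+1] n k) (nCk+nC[k+1]≡[n+1]C[k+1] n (suc k)) ⟨
    (n C k + n C suc k) + (n C suc k + n C suc (suc k))  ≡⟨ regroup (n C k) (n C suc k) (n C suc (suc k)) ⟩
    n C k + 2 * (n C suc k) + n C suc (suc k)            ∎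
    where
    regroup : ∀ x y z → (x + y) + (y + z) ≡ x + 2 * y + z
    regroup = solve-∀

  centralC-suc : ∀ n → (suc n + suc n) C suc n ≡ 2 * ((suc n + n) C suc n)
  centralC-suc n = begin
    suc (n + suc n) C suc n                    ≡⟨ nCk+nC[k+1]≡[n+1]C[k+1] (n + suc n) n ⟨
    (n + suc n) C n + (n + suc n) C suc n      ≡⟨ cong (_+ (n + suc n) C suc n) symmetric ⟩
    (n + suc n) C suc n + (n + suc n) C suc n  ≡⟨ cong (λ m → m C suc n + m C suc n) (ℕ.+-suc n n) ⟩
    (suc n + n) C suc n + (suc n + n) C suc n  ≡⟨ cong ((suc n + n) C suc n +_) (ℕ.+-identityʳ _) ⟨
    2 * ((suc n + n) C suc n)                  ∎
    where
    symmetric : (n + suc n) C n ≡ (n + suc n) C suc n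
    symmetric = trans (nCk≡nC[n∸k] (ℕ.m≤m+n n (suc n))) (cong ((n + suc n) C_) (ℕ.m+n∸m≡n n (suc n)))

  hockey-stick : ∀ k b → Σ< (suc b) (λ a → (k + a) C k) ≡ (suc k + b) C suc k
  hockey-stick k zero = begin
    (k + 0) C k + 0      ≡⟨ ℕ.+-identityʳ _ ⟩
    (k + 0) C k          ≡⟨ cong (_C k) (ℕ.+-identityʳ k) ⟩
    k C k                ≡⟨ nCn≡1 k ⟩
    1                    ≡⟨ nCn≡1 (suc k) ⟨
    suc k C suc k        ≡⟨ cong (λ m → suc m C suc k) (ℕ.+-identityʳ k) ⟨
    (suc k + 0) C suc k  ∎
  hockey-stick k (suc b) = begin
    Σ< (suc (suc b)) (λ a → (k + a) C k)              ≡⟨ Σ<-suc (suc b) (λ a → (k + a) C k) ⟩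
    Σ< (suc b) (λ a → (k + a) C k) + (k + suc b) C k  ≡⟨ cong (_+ (k + suc b) C k) (hockey-stick k b) ⟩
    (suc k + b) C suc k + (k + suc b) C k             ≡⟨ cong (λ m → m C suc k + (k + suc b) C k) (ℕ.+-suc k b) ⟨
    (k + suc b) C suc k + (k + suc b) C k             ≡⟨ ℕ.+-comm ((k + suc b) C suc k) _ ⟩
    (k + suc b) C k + (k + suc b) C suc k             ≡⟨ nCk+nC[k+1]≡[n+1]C[k+1] (k + suc b) k ⟩
    (suc k + suc b) C suc k                           ∎

module Dispositions where

  open import Data.Fin using (Fin; toℕ; inject₁) renaming (zero to fzero; suc to fsuc)
  open import Data.Fin.Properties using (toℕ<n)
  open import Data.List using (_++_; map; concatMap; length; filter; tabulate; allFin)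
  import Data.List.Properties as List
  open import Data.List.Relation.Unary.All using ([]; universal)
  open import Data.List.Relation.Unary.All.Properties using (map⁺; map⁻; tabulate⁺; tabulate⁻)
  open import Data.Nat using (_+_; _≤?_)
  open import Data.Nat.ListAction using (sum)
  open import Data.Product using (_×_; _,_; proj₁; proj₂)
  open import Data.Unit using (⊤; tt)
  open import Data.Vec using (Vec; []; _∷_; lookup)
  open import Relation.Nullary.Decidable using (_×-dec_)
  open import Relation.Unary using (Pred; Decidable; _≐_)
  open ℕΣ using (Σ<; Σ<-cong; Σ<-vanishing)
  open Binomial using (hockey-stick)
  open ≡-Reasoning

  module _ {a p} {A : Set a} {P : Pred A p} (P? : Decidable P) where

    length-filter-map : ∀ {b} {B : Set b} (f : B → A) xs →
                        length (filter P? (map f xs)) ≡ length (filter (P? ∘ f) xs)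
    length-filter-map f []       = refl
    length-filter-map f (x ∷ xs) with does (P? (f x))
    ... | true  = cong suc (length-filter-map f xs)
    ... | false = length-filter-map f xs

    length-filter-concatMap : ∀ {b} {B : Set b} (f : B → List A) xs →
                              length (filter P? (concatMap f xs)) ≡ sum (map (length ∘ filter P? ∘ f) xs)
    length-filter-concatMap f []       = refl
    length-filter-concatMap f (x ∷ xs) = begin
      length (filter P? (f x ++ concatMap f xs))                      ≡⟨ cong length (List.filter-++ P? (f x) _) ⟩
      length (filter P? (f x) ++ filter P? (concatMap f xs))          ≡⟨ List.length-++ (filter P? (f x)) ⟩
      length (filter P? (f x)) + length (filter P? (concatMap f xs))  ≡⟨ cong (length (filter P? (f x)) +_) (length-filter-concatMap f xs) ⟩
      sum (map (length ∘ filter P? ∘ f) (x ∷ xs))                     ∎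

  sum-tabulate : ∀ n (f : Fin n → ℕ) g → (∀ a → f a ≡ g (toℕ a)) → sum (tabulate f) ≡ Σ< n g
  sum-tabulate zero    f g f≡g = refl
  sum-tabulate (suc n) f g f≡g = cong₂ _+_ (f≡g fzero) (sum-tabulate n (f ∘ fsuc) (g ∘ suc) (f≡g ∘ fsuc))

  module NonIncreasing (i : ℕ) where

    NonIncreasingFrom : ℕ → ∀ {k} → Vec (Fin i) k → Set
    NonIncreasingFrom b []      = ⊤
    NonIncreasingFrom b (x ∷ v) = toℕ x ≤ b × NonIncreasingFrom (toℕ x) v

    nonIncreasingFrom? : ∀ b {k} → Decidable (NonIncreasingFrom b {k})
    nonIncreasingFrom? b []      = yes tt
    nonIncreasingFrom? b (x ∷ v) = (toℕ x ≤? b) ×-dec nonIncreasingFrom? (toℕ x) v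

    #nonIncreasingFrom : ℕ → ℕ → ℕ
    #nonIncreasingFrom k b = length (filter (nonIncreasingFrom? b) (allVecs i k))

    #nonIncreasingFrom-headed : ∀ k b (x : Fin i) →
      length (filter (nonIncreasingFrom? b) (map (x ∷_) (allVecs i k)))
        ≡ (if does (toℕ x ≤? b) then #nonIncreasingFrom k (toℕ x) else 0)
    #nonIncreasingFrom-headed k b x
      rewrite length-filter-map (nonIncreasingFrom? b) (x ∷_) (allVecs i k) with toℕ x ≤? b
    ... | yes x≤b = trans (cong length (List.filter-≐ _ _ (proj₂ , (x≤b ,_)) (allVecs i k)))
                          (cong (λ c → if c then _ else 0) (sym (dec-true (toℕ x ≤? b) x≤b)))
    ... | no  x≰b = trans (cong length (List.filter-none _ (universal (λ _ → x≰b ∘ proj₁) (allVecs i k))))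
                          (cong (λ c → if c then _ else 0) (sym (dec-false (toℕ x ≤? b) x≰b)))

    #nonIncreasingFrom-suc : ∀ k b →
      #nonIncreasingFrom (suc k) b ≡ Σ< i (λ a → if does (a ≤? b) then #nonIncreasingFrom k a else 0)
    #nonIncreasingFrom-suc k b = begin
      length (filter (nonIncreasingFrom? b) (concatMap headed (allFin i)))
        ≡⟨ length-filter-concatMap (nonIncreasingFrom? b) headed (allFin i) ⟩
      sum (map (length ∘ filter (nonIncreasingFrom? b) ∘ headed) (allFin i))
        ≡⟨ cong sum (List.map-tabulate {n = i} (λ x → x) (length ∘ filter (nonIncreasingFrom? b) ∘ headed)) ⟩
      sum (tabulate (length ∘ filter (nonIncreasingFrom? b) ∘ headed))
        ≡⟨ sum-tabulate i _ _ (#nonIncreasingFrom-headed k b) ⟩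
      Σ< i (λ a → if does (a ≤? b) then #nonIncreasingFrom k a else 0) ∎
      where
      headed : Fin i → List (Vec (Fin i) (suc k))
      headed x = map (x ∷_) (allVecs i k)

    #nonIncreasingFrom≡C : ∀ k b → b < i → #nonIncreasingFrom k b ≡ (k + b) C k
    #nonIncreasingFrom≡C zero    b b<i = refl
    #nonIncreasingFrom≡C (suc k) b b<i = begin
      #nonIncreasingFrom (suc k) b    ≡⟨ #nonIncreasingFrom-suc k b ⟩
      Σ< i bounded                    ≡⟨ Σ<-vanishing bounded b<i bounded≡0 ⟩
      Σ< (suc b) bounded              ≡⟨ Σ<-cong (suc b) bounded≡C ⟩
      Σ< (suc b) (λ a → (k + a) C k)  ≡⟨ hockey-stick k b ⟩
      (suc k + b) C suc k             ∎
      where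
      bounded : ℕ → ℕ
      bounded a = if does (a ≤? b) then #nonIncreasingFrom k a else 0
      bounded≡0 : ∀ a → suc b ≤ a → bounded a ≡ 0
      bounded≡0 a b<a = cong (λ c → if c then _ else 0) (dec-false (a ≤? b) (ℕ.<⇒≱ b<a))
      bounded≡C : ∀ a → a < suc b → bounded a ≡ (k + a) C k
      bounded≡C a (s≤s a≤b) = trans (cong (λ c → if c then _ else 0) (dec-true (a ≤? b) a≤b))
                                    (#nonIncreasingFrom≡C k a (ℕ.≤-<-trans a≤b b<i))

  open NonIncreasing using (NonIncreasingFrom; nonIncreasingFrom?; #nonIncreasingFrom≡C)

  pathDisposition≐nonIncreasingFrom : ∀ n b →
    IsNonStrictDisposition (P n) (suc b) ≐ NonIncreasingFrom (suc b) b
  pathDisposition≐nonIncreasingFrom zero    b = (λ { {[]} _ → tt }) , (λ { {[]} _ → [] })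
  pathDisposition≐nonIncreasingFrom (suc k) b =
    (λ { {x ∷ w} d → ℕ.≤-pred (toℕ<n x) , fromAdjacent x w (tabulate⁻ (map⁻ d)) }) ,
    (λ { {x ∷ w} (_ , ni) → map⁺ (tabulate⁺ (toAdjacent x w ni)) })
    where
    Adjacent : ∀ {m} → Vec (Fin (suc b)) (suc m) → Set
    Adjacent {m} v = ∀ (j : Fin m) → toℕ (lookup v (fsuc j)) ≤ toℕ (lookup v (inject₁ j))
    fromAdjacent : ∀ {m} x (w : Vec _ m) → Adjacent (x ∷ w) → NonIncreasingFrom (suc b) (toℕ x) w
    fromAdjacent x []      adj = tt
    fromAdjacent x (y ∷ w) adj = adj fzero , fromAdjacent y w (adj ∘ fsuc)
    toAdjacent : ∀ {m} x (w : Vec _ m) → NonIncreasingFrom (suc b) (toℕ x) w → Adjacent (x ∷ w)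
    toAdjacent x (y ∷ w) (y≤x , ni) fzero    = y≤x
    toAdjacent x (y ∷ w) (y≤x , ni) (fsuc j) = toAdjacent y w ni j

  σnsᵢ-path : ∀ n b → σnsᵢ (suc b) (P n) ≡ (n + b) C n
  σnsᵢ-path n b = begin
    length (filter (isNonStrictDisposition? (P n) (suc b)) (allVecs (suc b) n))
      ≡⟨ cong length (List.filter-≐ _ _ (pathDisposition≐nonIncreasingFrom n b) (allVecs (suc b) n)) ⟩
    length (filter (nonIncreasingFrom? (suc b) b) (allVecs (suc b) n))
      ≡⟨ #nonIncreasingFrom≡C (suc b) n b ℕ.≤-refl ⟩
    (n + b) C n ∎

module Trinomial where

  open import Data.Nat using (_+_; _*_; _^_)
  open import Algebra.Properties.CommutativeSemigroup ℕ.+-commutativeSemigroup using (xy∙z≈zy∙x)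
  open ℕΣ using (Σ<; Σ<-cong; Σ<-distrib-+; *-distribˡ-Σ<; Σ<-vanishing)
  open Binomial using (C-pascal²; centralC-suc)
  open ≡-Reasoning

  shift : (ℕ → ℕ) → ℕ → ℕ
  shift f zero    = 0
  shift f (suc a) = f a

  shift-cong : ∀ {f g} → (∀ a → f a ≡ g a) → ∀ a → shift f a ≡ shift g a
  shift-cong f≡g zero    = refl
  shift-cong f≡g (suc a) = f≡g a

  -- the coefficient of Xᵃ Yᶜ in (X + 2 + Y)ⁿ
  trinomial : ℕ → ℕ → ℕ → ℕ
  trinomial zero    zero    zero    = 1
  trinomial zero    zero    (suc c) = 0
  trinomial zero    (suc a) c       = 0
  trinomial (suc n) a c = shift (λ a′ → trinomial n a′ c) a + 2 * trinomial n a c + shift (trinomial n a) c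

  trinomial-sym : ∀ n a c → trinomial n a c ≡ trinomial n c a
  trinomial-sym zero    zero    zero    = refl
  trinomial-sym zero    zero    (suc c) = refl
  trinomial-sym zero    (suc a) zero    = refl
  trinomial-sym zero    (suc a) (suc c) = refl
  trinomial-sym (suc n) a c = trans
    (cong₂ _+_ (cong₂ _+_ (shift-cong (λ a′ → trinomial-sym n a′ c) a) (cong (2 *_) (trinomial-sym n a c)))
               (shift-cong (λ c′ → trinomial-sym n a c′) c))
    (xy∙z≈zy∙x (shift (trinomial n c) a) (2 * trinomial n c a) (shift (λ c′ → trinomial n c′ a) c))

  trinomial-vanishing : ∀ n a c → n < a + c → trinomial n a c ≡ 0
  trinomial-vanishing zero    zero    (suc c) _    = refl
  trinomial-vanishing zero    (suc a) c       _    = refl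
  trinomial-vanishing (suc n) a c n<a+c =
    cong₂ _+_ (cong₂ _+_ (left a n<a+c) (cong (2 *_) (trinomial-vanishing n a c (ℕ.<-trans (ℕ.n<1+n n) n<a+c))))
              (right c n<a+c)
    where
    left : ∀ a → suc n < a + c → shift (λ a′ → trinomial n a′ c) a ≡ 0
    left zero    _             = refl
    left (suc a) (s≤s n<a+c) = trinomial-vanishing n a c n<a+c
    right : ∀ c → suc n < a + c → shift (trinomial n a) c ≡ 0
    right zero    _           = refl
    right (suc c) n<a+1+c = trinomial-vanishing n a c (ℕ.≤-pred (subst (suc n <_) (ℕ.+-suc a c) n<a+1+c))

  trinomial-closed : ∀ n a b c → n ≡ a + b + c → trinomial n a c * (a ! * b ! * c !) ≡ n ! * 2 ^ b
  trinomial-closed zero    zero    zero    zero    refl = refl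
  trinomial-closed (suc m) a b c eq = begin
    (L + 2 * M + R) * K            ≡⟨ distrib L (2 * M) R K ⟩
    L * K + 2 * M * K + R * K      ≡⟨ cong₂ _+_ (cong₂ _+_ (left a eq) (middle b eq)) (right c eq) ⟩
    a * X + b * X + c * X          ≡⟨ distrib a b c X ⟨
    (a + b + c) * X                ≡⟨ cong (_* X) eq ⟨
    suc m * (m ! * 2 ^ b)          ≡⟨ ℕ.*-assoc (suc m) (m !) (2 ^ b) ⟨
    suc m ! * 2 ^ b                ∎
    where
    L = shift (λ a′ → trinomial m a′ c) a
    M = trinomial m a c
    R = shift (trinomial m a) c
    K = a ! * b ! * c !
    X = m ! * 2 ^ b

    distrib : ∀ x y z k → (x + y + z) * k ≡ x * k + y * k + z * k
    distrib = solve-∀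

    left : ∀ a → suc m ≡ a + b + c → shift (λ a′ → trinomial m a′ c) a * (a ! * b ! * c !) ≡ a * X
    left zero    _  = refl
    left (suc a) eq = begin
      trinomial m a c * (suc a * a ! * b ! * c !)    ≡⟨ regroup (trinomial m a c) (suc a) (a !) (b !) (c !) ⟩
      suc a * (trinomial m a c * (a ! * b ! * c !))  ≡⟨ cong (suc a *_) (trinomial-closed m a b c (ℕ.suc-injective eq)) ⟩
      suc a * X                                      ∎
      where
      regroup : ∀ t s x y z → t * (s * x * y * z) ≡ s * (t * (x * y * z))
      regroup = solve-∀

    middle : ∀ b → suc m ≡ a + b + c → 2 * M * (a ! * b ! * c !) ≡ b * (m ! * 2 ^ b)
    middle zero    eq = cong (λ t → 2 * t * (a ! * 1 * c !)) (trinomial-vanishing m a c m<a+c)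
      where
      m<a+c : m < a + c
      m<a+c = ℕ.≤-reflexive (trans eq (cong (_+ c) (ℕ.+-identityʳ a)))
    middle (suc b) eq = begin
      2 * M * (a ! * (suc b * b !) * c !)    ≡⟨ regroup M (suc b) (a !) (b !) (c !) ⟩
      suc b * 2 * (M * (a ! * b ! * c !))    ≡⟨ cong (suc b * 2 *_) (trinomial-closed m a b c m≡a+b+c) ⟩
      suc b * 2 * (m ! * 2 ^ b)              ≡⟨ regroup′ (suc b) (m !) (2 ^ b) ⟩
      suc b * (m ! * 2 ^ suc b)              ∎
      where
      m≡a+b+c : m ≡ a + b + c
      m≡a+b+c = ℕ.suc-injective (trans eq (cong (_+ c) (ℕ.+-suc a b)))
      regroup : ∀ t s x y z → 2 * t * (x * (s * y) * z) ≡ s * 2 * (t * (x * y * z))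
      regroup = solve-∀
      regroup′ : ∀ s x p → s * 2 * (x * p) ≡ s * (x * (2 * p))
      regroup′ = solve-∀

    right : ∀ c → suc m ≡ a + b + c → shift (trinomial m a) c * (a ! * b ! * c !) ≡ c * X
    right zero    _  = refl
    right (suc c) eq = begin
      trinomial m a c * (a ! * b ! * (suc c * c !))  ≡⟨ regroup (trinomial m a c) (suc c) (a !) (b !) (c !) ⟩
      suc c * (trinomial m a c * (a ! * b ! * c !))  ≡⟨ cong (suc c *_) (trinomial-closed m a b c m≡a+b+c) ⟩
      suc c * X                                      ∎
      where
      m≡a+b+c : m ≡ a + b + c
      m≡a+b+c = ℕ.suc-injective (trans eq (ℕ.+-suc (a + b) c))
      regroup : ∀ t s x y z → t * (x * y * (s * z)) ≡ s * (t * (x * y * z))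
      regroup = solve-∀

  -- the coefficient of Xᵉ in (X + 2 + X⁻¹)ⁿ = X⁻ⁿ (1 + X)²ⁿ
  diagonal : ℕ → ℕ → ℕ
  diagonal n e = Σ< (suc n) (λ a → trinomial n a (e + a))

  diagonal-extend : ∀ n e → Σ< (suc (suc n)) (λ a → trinomial n a (e + a)) ≡ diagonal n e
  diagonal-extend n e = Σ<-vanishing _ (ℕ.n≤1+n (suc n))
    (λ a n<a → trinomial-vanishing n a (e + a) (ℕ.<-≤-trans n<a (ℕ.m≤m+n a (e + a))))

  diagonal-split : ∀ n e → diagonal (suc n) e
    ≡ diagonal n (suc e) + 2 * diagonal n e + Σ< (suc (suc n)) (λ a → shift (trinomial n a) (e + a))
  diagonal-split n e = begin
    Σ² (λ a → L a + 2 * M a + R a)      ≡⟨ Σ<-distrib-+ (suc (suc n)) (λ a → L a + 2 * M a) R ⟩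
    Σ² (λ a → L a + 2 * M a) + Σ² R     ≡⟨ cong (_+ Σ² R) (Σ<-distrib-+ (suc (suc n)) L (λ a → 2 * M a)) ⟩
    Σ² L + Σ² (λ a → 2 * M a) + Σ² R    ≡⟨ cong₂ (λ x y → x + y + Σ² R) left middle ⟩
    diagonal n (suc e) + 2 * diagonal n e + Σ² R  ∎
    where
    Σ² : (ℕ → ℕ) → ℕ
    Σ² = Σ< (suc (suc n))
    L M R : ℕ → ℕ
    L a = shift (λ a′ → trinomial n a′ (e + a)) a
    M a = trinomial n a (e + a)
    R a = shift (trinomial n a) (e + a)
    left : Σ² L ≡ diagonal n (suc e)
    left = Σ<-cong (suc n) (λ a _ → cong (trinomial n a) (ℕ.+-suc e a))
    middle : Σ² (λ a → 2 * M a) ≡ 2 * diagonal n e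
    middle = trans (sym (*-distribˡ-Σ< (suc (suc n)) 2 M)) (cong (2 *_) (diagonal-extend n e))

  diagonal-suc-zero : ∀ n → diagonal (suc n) 0 ≡ diagonal n 1 + 2 * diagonal n 0 + diagonal n 1
  diagonal-suc-zero n = trans (diagonal-split n 0)
    (cong (diagonal n 1 + 2 * diagonal n 0 +_) (Σ<-cong (suc n) (λ a _ → trinomial-sym n (suc a) a)))

  diagonal-suc-suc : ∀ n e →
    diagonal (suc n) (suc e) ≡ diagonal n (suc (suc e)) + 2 * diagonal n (suc e) + diagonal n e
  diagonal-suc-suc n e = trans (diagonal-split n (suc e))
    (cong (diagonal n (suc (suc e)) + 2 * diagonal n (suc e) +_) (diagonal-extend n e))

  diagonal≡C : ∀ n e → diagonal n e ≡ (n + n) C (n + e)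
  diagonal≡C zero    zero    = refl
  diagonal≡C zero    (suc e) = refl
  diagonal≡C (suc n) zero    = begin
    diagonal (suc n) 0                                          ≡⟨ diagonal-suc-zero n ⟩
    diagonal n 1 + 2 * diagonal n 0 + diagonal n 1              ≡⟨ cong₂ (λ x y → x + 2 * y + x) (diagonal≡C n 1) (diagonal≡C n 0) ⟩
    (n + n) C (n + 1) + 2 * ((n + n) C (n + 0)) + (n + n) C (n + 1)
      ≡⟨ cong₂ (λ k l → (n + n) C k + 2 * ((n + n) C l) + (n + n) C k) (ℕ.+-comm n 1) (ℕ.+-identityʳ n) ⟩
    (n + n) C suc n + 2 * ((n + n) C n) + (n + n) C suc n       ≡⟨ regroup ((n + n) C suc n) ((n + n) C n) ⟩
    2 * ((n + n) C n + (n + n) C suc n)                         ≡⟨ cong (2 *_) (nCk+nC[k+1]≡[n+1]C[k+1] (n + n) n) ⟩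
    2 * ((suc n + n) C suc n)                                   ≡⟨ centralC-suc n ⟨
    (suc n + suc n) C suc n                                     ≡⟨ cong ((suc n + suc n) C_) (ℕ.+-identityʳ (suc n)) ⟨
    (suc n + suc n) C (suc n + 0)                               ∎
    where
    regroup : ∀ x y → x + 2 * y + x ≡ 2 * (y + x)
    regroup = solve-∀
  diagonal≡C (suc n) (suc e) = begin
    diagonal (suc n) (suc e)                                    ≡⟨ diagonal-suc-suc n e ⟩
    diagonal n (suc (suc e)) + 2 * diagonal n (suc e) + diagonal n e
      ≡⟨ cong₂ _+_ (cong₂ (λ x y → x + 2 * y) (diagonal≡C n (suc (suc e))) (diagonal≡C n (suc e))) (diagonal≡C n e) ⟩
    (n + n) C (n + suc (suc e)) + 2 * ((n + n) C (n + suc e)) + (n + n) C (n + e)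
      ≡⟨ cong₂ (λ k l → (n + n) C k + 2 * ((n + n) C l) + (n + n) C (n + e)) (trans (ℕ.+-suc n (suc e)) (cong suc (ℕ.+-suc n e))) (ℕ.+-suc n e) ⟩
    (n + n) C suc (suc (n + e)) + 2 * ((n + n) C suc (n + e)) + (n + n) C (n + e)
      ≡⟨ xy∙z≈zy∙x ((n + n) C suc (suc (n + e))) (2 * ((n + n) C suc (n + e))) ((n + n) C (n + e)) ⟩
    (n + n) C (n + e) + 2 * ((n + n) C suc (n + e)) + (n + n) C suc (suc (n + e))
      ≡⟨ C-pascal² (n + n) (n + e) ⟨
    suc (suc (n + n)) C suc (suc (n + e))                       ≡⟨ cong₂ (λ k l → suc k C suc l) (ℕ.+-suc n n) (ℕ.+-suc n e) ⟨
    (suc n + suc n) C (suc n + suc e)                           ∎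

open import Data.Integer as ℤ using (+_)
import Data.Integer.Properties as ℤ
open import Data.Rational as ℚ using (ℚ; 0ℚ; 1ℚ; ½; _+_; _*_; toℚᵘ)
import Data.Rational.Properties as ℚ
open import Data.Rational.Solver using (module +-*-Solver)
import Data.Rational.Unnormalised as ℚᵘ
import Data.Rational.Unnormalised.Properties as ℚᵘ
open Binomial using (centralC-suc)
open Dispositions using (σnsᵢ-path)
open Trinomial using (trinomial; trinomial-closed; trinomial-vanishing; diagonal≡C)

module ℚΣ = FiniteSum (CommutativeRing.commutativeSemiring ℚ.+-*-commutativeRing)

fromℕ : ℕ → ℚ
fromℕ k = + k ℚ./ 1

toℚᵘ-fromℕ : ∀ k → toℚᵘ (fromℕ k) ℚᵘ.≃ ℚᵘ.mkℚᵘ (+ k) 0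
toℚᵘ-fromℕ k = ℚ.toℚᵘ-fromℚᵘ (ℚᵘ.mkℚᵘ (+ k) 0)

fromℕ-homo-+ : ∀ a b → fromℕ (a ℕ.+ b) ≡ fromℕ a + fromℕ b
fromℕ-homo-+ a b = ℚ.toℚᵘ-injective (begin
  toℚᵘ (fromℕ (a ℕ.+ b))                ≈⟨ toℚᵘ-fromℕ (a ℕ.+ b) ⟩
  ℚᵘ.mkℚᵘ (+ (a ℕ.+ b)) 0               ≈⟨ ℚᵘ.*≡* (cong (ℤ._* + 1) numerators) ⟩
  ℚᵘ.mkℚᵘ (+ a) 0 ℚᵘ.+ ℚᵘ.mkℚᵘ (+ b) 0  ≈⟨ ℚᵘ.+-cong (toℚᵘ-fromℕ a) (toℚᵘ-fromℕ b) ⟨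
  toℚᵘ (fromℕ a) ℚᵘ.+ toℚᵘ (fromℕ b)    ≈⟨ ℚ.toℚᵘ-homo-+ (fromℕ a) (fromℕ b) ⟨
  toℚᵘ (fromℕ a + fromℕ b)              ∎)
  where
  open ℚᵘ.≃-Reasoning
  numerators : + (a ℕ.+ b) ≡ + a ℤ.* + 1 ℤ.+ + b ℤ.* + 1
  numerators = trans (ℤ.pos-+ a b) (sym (cong₂ ℤ._+_ (ℤ.*-identityʳ (+ a)) (ℤ.*-identityʳ (+ b))))

fromℕ-homo-* : ∀ a b → fromℕ (a ℕ.* b) ≡ fromℕ a * fromℕ b
fromℕ-homo-* a b = ℚ.toℚᵘ-injective (begin
  toℚᵘ (fromℕ (a ℕ.* b))                ≈⟨ toℚᵘ-fromℕ (a ℕ.* b) ⟩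
  ℚᵘ.mkℚᵘ (+ (a ℕ.* b)) 0               ≈⟨ ℚᵘ.*≡* (cong (ℤ._* + 1) (ℤ.pos-* a b)) ⟩
  ℚᵘ.mkℚᵘ (+ a) 0 ℚᵘ.* ℚᵘ.mkℚᵘ (+ b) 0  ≈⟨ ℚᵘ.*-cong (toℚᵘ-fromℕ a) (toℚᵘ-fromℕ b) ⟨
  toℚᵘ (fromℕ a) ℚᵘ.* toℚᵘ (fromℕ b)    ≈⟨ ℚ.toℚᵘ-homo-* (fromℕ a) (fromℕ b) ⟨
  toℚᵘ (fromℕ a * fromℕ b)              ∎)
  where open ℚᵘ.≃-Reasoning

fromℕ-*-inverse : ∀ m .{{_ : ℕ.NonZero m}} → fromℕ m * (+ 1 ℚ./ m) ≡ 1ℚ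
fromℕ-*-inverse (suc d) = ℚ.toℚᵘ-injective (begin
  toℚᵘ (fromℕ (suc d) * (+ 1 ℚ./ suc d))        ≈⟨ ℚ.toℚᵘ-homo-* (fromℕ (suc d)) (+ 1 ℚ./ suc d) ⟩
  toℚᵘ (fromℕ (suc d)) ℚᵘ.* toℚᵘ (+ 1 ℚ./ suc d) ≈⟨ ℚᵘ.*-cong (toℚᵘ-fromℕ (suc d)) (ℚ.toℚᵘ-fromℚᵘ (ℚᵘ.mkℚᵘ (+ 1) d)) ⟩
  ℚᵘ.mkℚᵘ (+ suc d) 0 ℚᵘ.* ℚᵘ.mkℚᵘ (+ 1) d        ≈⟨ ℚᵘ.*≡* (cong (λ k → + suc k) d*1*1≡d+0+0) ⟩
  toℚᵘ 1ℚ                                       ∎)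
  where
  open ℚᵘ.≃-Reasoning
  d*1*1≡d+0+0 : d ℕ.* 1 ℕ.* 1 ≡ d ℕ.+ 0 ℕ.+ 0
  d*1*1≡d+0+0 = trans (trans (ℕ.*-identityʳ (d ℕ.* 1)) (ℕ.*-identityʳ d))
                      (sym (trans (ℕ.+-identityʳ (d ℕ.+ 0)) (ℕ.+-identityʳ d)))

1/!-inverse : ∀ n → fromℕ (n !) * 1/! n ≡ 1ℚ
1/!-inverse n = fromℕ-*-inverse (n !) {{ℕ._!≢0 n}}

fromℕ-homo-Σ< : ∀ n f → ℚΣ.Σ< n (fromℕ ∘ f) ≡ fromℕ (ℕΣ.Σ< n f)
fromℕ-homo-Σ< zero    f = refl
fromℕ-homo-Σ< (suc n) f =
  trans (cong (ℚ._+_ (fromℕ (f 0))) (fromℕ-homo-Σ< n (f ∘ suc))) (sym (fromℕ-homo-+ (f 0) _))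

pow-fromℕ : ∀ m b → pow (fromℕ m) b ≡ fromℕ (m ℕ.^ b)
pow-fromℕ m zero    = refl
pow-fromℕ m (suc b) = trans (cong (fromℕ m *_) (pow-fromℕ m b)) (sym (fromℕ-homo-* m (m ℕ.^ b)))

open +-*-Solver using (solve; _:*_; _:=_)

pow-inverse : ∀ {x y} → x * y ≡ 1ℚ → ∀ n → pow x n * pow y n ≡ 1ℚ
pow-inverse         xy≡1 zero    = refl
pow-inverse {x} {y} xy≡1 (suc n) = begin
  (x * pow x n) * (y * pow y n)  ≡⟨ solve 4 (λ x a y b → (x :* a) :* (y :* b) := (x :* y) :* (a :* b))
                                           refl x (pow x n) y (pow y n) ⟩
  (x * y) * (pow x n * pow y n)  ≡⟨ cong₂ _*_ xy≡1 (pow-inverse xy≡1 n) ⟩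
  1ℚ * 1ℚ                        ≡⟨⟩
  1ℚ                             ∎
  where open ≡-Reasoning

trinomial/! : ∀ n a b c → n ≡ a ℕ.+ b ℕ.+ c →
              fromℕ (trinomial n a c) * 1/! n ≡ (pow two b * 1/! b) * (1/! a * 1/! c)
trinomial/! n a b c n≡a+b+c = begin
  T * ν                                       ≡⟨ ℚ.*-identityʳ (T * ν) ⟨
  T * ν * 1ℚ                                  ≡⟨ cong (T * ν *_) factorials/factorials ⟨
  T * ν * ((Fa * α) * ((Fb * β) * (Fc * γ)))  ≡⟨ solve 8 (λ T ν Fa α Fb β Fc γ →
                                                   T :* ν :* ((Fa :* α) :* ((Fb :* β) :* (Fc :* γ))) :=
                                                   (T :* (Fa :* Fb :* Fc)) :* (ν :* (β :* (α :* γ))))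
                                                 refl T ν Fa α Fb β Fc γ ⟩
  (T * (Fa * Fb * Fc)) * (ν * (β * (α * γ)))  ≡⟨ cong (_* (ν * (β * (α * γ)))) closed ⟩
  (Fn * 2ᵇ) * (ν * (β * (α * γ)))             ≡⟨ solve 6 (λ Fn 2ᵇ ν β α γ →
                                                   (Fn :* 2ᵇ) :* (ν :* (β :* (α :* γ))) := (Fn :* ν) :* ((2ᵇ :* β) :* (α :* γ)))
                                                 refl Fn 2ᵇ ν β α γ ⟩
  (Fn * ν) * ((2ᵇ * β) * (α * γ))             ≡⟨ cong (_* ((2ᵇ * β) * (α * γ))) (1/!-inverse n) ⟩
  1ℚ * ((2ᵇ * β) * (α * γ))                   ≡⟨ ℚ.*-identityˡ _ ⟩
  (2ᵇ * β) * (α * γ)                          ∎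
  where
  open ≡-Reasoning
  T  = fromℕ (trinomial n a c)
  Fn = fromℕ (n !)
  Fa = fromℕ (a !)
  Fb = fromℕ (b !)
  Fc = fromℕ (c !)
  2ᵇ = pow two b
  ν  = 1/! n
  α  = 1/! a
  β  = 1/! b
  γ  = 1/! c
  factorials/factorials : (Fa * α) * ((Fb * β) * (Fc * γ)) ≡ 1ℚ
  factorials/factorials rewrite 1/!-inverse a | 1/!-inverse b | 1/!-inverse c = refl
  closed : T * (Fa * Fb * Fc) ≡ Fn * 2ᵇ
  closed = begin
    T * (Fa * Fb * Fc)                                 ≡⟨ cong (T *_) (trans (cong (_* Fc) (sym (fromℕ-homo-* (a !) (b !))))
                                                                             (sym (fromℕ-homo-* (a ! ℕ.* b !) (c !)))) ⟩
    T * fromℕ (a ! ℕ.* b ! ℕ.* c !)                    ≡⟨ fromℕ-homo-* (trinomial n a c) (a ! ℕ.* b ! ℕ.* c !) ⟨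
    fromℕ (trinomial n a c ℕ.* (a ! ℕ.* b ! ℕ.* c !))  ≡⟨ cong fromℕ (trinomial-closed n a b c n≡a+b+c) ⟩
    fromℕ (n ! ℕ.* 2 ℕ.^ b)                            ≡⟨ fromℕ-homo-* (n !) (2 ℕ.^ b) ⟩
    Fn * fromℕ (2 ℕ.^ b)                               ≡⟨ cong (Fn *_) (pow-fromℕ 2 b) ⟨
    Fn * 2ᵇ                                            ∎

exp⊛I₀ : FPS
exp⊛I₀ = scaleArg two expS ⊛ scaleArg two I₀S

exp⊛I₀-term : ∀ n j → j ≤ n →
  scaleArg two expS (n ∸ j) * scaleArg two I₀S (n ∸ (n ∸ j))
    ≡ (if ⌊ 2 ∣? j ⌋ then fromℕ (trinomial n (j / 2) (j / 2)) * 1/! n else 0ℚ)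
exp⊛I₀-term n j j≤n rewrite ℕ.m∸[m∸n]≡n j≤n with 2 ∣? j
... | no  _   = trans (cong (scaleArg two expS (n ∸ j) *_) (ℚ.*-zeroʳ (pow two j)))
                      (ℚ.*-zeroʳ (scaleArg two expS (n ∸ j)))
... | yes 2∣j = begin
  (pow two b * 1/! b) * (pow two j * (pow ½ j * (1/! s * 1/! s)))  ≡⟨ cong ((pow two b * 1/! b) *_) cancel ⟩
  (pow two b * 1/! b) * (1/! s * 1/! s)                            ≡⟨ trinomial/! n s b s n≡s+b+s ⟨
  fromℕ (trinomial n s s) * 1/! n                                  ∎
  where
  open ≡-Reasoning
  s = j / 2
  b = n ∸ j
  cancel : pow two j * (pow ½ j * (1/! s * 1/! s)) ≡ 1/! s * 1/! s
  cancel = trans (sym (ℚ.*-assoc (pow two j) (pow ½ j) _))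
                 (trans (cong (_* (1/! s * 1/! s)) (pow-inverse refl j)) (ℚ.*-identityˡ _))
  n≡s+b+s : n ≡ s ℕ.+ b ℕ.+ s
  n≡s+b+s = trans (sym (ℕ.m+[n∸m]≡n j≤n)) (trans (cong (ℕ._+ b) (sym (ℕ.m*[n/m]≡n 2∣j))) (regroup s b))
    where
    regroup : ∀ s b → 2 ℕ.* s ℕ.+ b ≡ s ℕ.+ b ℕ.+ s
    regroup = solve-∀

exp⊛I₀-coefficient : ∀ n → exp⊛I₀ n ≡ fromℕ ((n ℕ.+ n) C n) * 1/! n
exp⊛I₀-coefficient n = begin
  sumTo n F                                                    ≡⟨ ℚΣ.foldr-applyUpTo F (λ k → k) (suc n) ⟩
  ℚΣ.Σ< (suc n) F                                              ≡⟨ ℚΣ.Σ<-reverse (suc n) F ⟩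
  ℚΣ.Σ< (suc n) (λ j → F (n ∸ j))                              ≡⟨ ℚΣ.Σ<-cong (suc n) (λ j j≤n → exp⊛I₀-term n j (ℕ.≤-pred j≤n)) ⟩
  ℚΣ.Σ< (suc n) (λ j → if ⌊ 2 ∣? j ⌋ then c (j / 2) else 0ℚ)  ≡⟨ ℚΣ.Σ<-evens n c c≡0 ⟩
  ℚΣ.Σ< (suc n) c                                              ≡⟨ ℚΣ.*-distribʳ-Σ< (suc n) (fromℕ ∘ central) (1/! n) ⟨
  ℚΣ.Σ< (suc n) (fromℕ ∘ central) * 1/! n                      ≡⟨ cong (_* 1/! n) (fromℕ-homo-Σ< (suc n) central) ⟩
  fromℕ (ℕΣ.Σ< (suc n) central) * 1/! n                        ≡⟨ cong (λ k → fromℕ k * 1/! n) (diagonal≡C n 0) ⟩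
  fromℕ ((n ℕ.+ n) C (n ℕ.+ 0)) * 1/! n                        ≡⟨ cong (λ k → fromℕ ((n ℕ.+ n) C k) * 1/! n) (ℕ.+-identityʳ n) ⟩
  fromℕ ((n ℕ.+ n) C n) * 1/! n                                ∎
  where
  open ≡-Reasoning
  F : ℕ → ℚ
  F k = scaleArg two expS k * scaleArg two I₀S (n ∸ k)
  central : ℕ → ℕ
  central s = trinomial n s s
  c : ℕ → ℚ
  c s = fromℕ (central s) * 1/! n
  c≡0 : ∀ s → n < 2 ℕ.* s → c s ≡ 0ℚ
  c≡0 s n<2s = trans (cong (λ t → fromℕ t * 1/! n) (trinomial-vanishing n s s n<s+s)) (ℚ.*-zeroˡ (1/! n))
    where
    n<s+s : n < s ℕ.+ s
    n<s+s = subst (n <_) (cong (s ℕ.+_) (ℕ.+-identityʳ s)) n<2s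

½-*-double : ∀ k x → ½ * (fromℕ (2 ℕ.* k) * x) ≡ fromℕ k * x
½-*-double k x = begin
  ½ * (fromℕ (2 ℕ.* k) * x)  ≡⟨ cong (λ y → ½ * (y * x)) (fromℕ-homo-* 2 k) ⟩
  ½ * ((two * fromℕ k) * x)  ≡⟨ solve 4 (λ h t y x → h :* ((t :* y) :* x) := (h :* t) :* (y :* x)) refl ½ two (fromℕ k) x ⟩
  (½ * two) * (fromℕ k * x)  ≡⟨ ℚ.*-identityˡ (fromℕ k * x) ⟩
  fromℕ k * x                ∎
  where open ≡-Reasoning

mainTheorem16 : (n : ℕ) → lhsS n ≡ rhsS n
mainTheorem16 zero    = refl
mainTheorem16 (suc m) = sym (begin
  ½ * (0ℚ + exp⊛I₀ n)                    ≡⟨ cong (½ *_) (ℚ.+-identityˡ (exp⊛I₀ n)) ⟩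
  ½ * exp⊛I₀ n                           ≡⟨ cong (½ *_) (exp⊛I₀-coefficient n) ⟩
  ½ * (fromℕ ((n ℕ.+ n) C n) * 1/! n)    ≡⟨ cong (λ k → ½ * (fromℕ k * 1/! n)) central≡2σ ⟩
  ½ * (fromℕ (2 ℕ.* σns (P n)) * 1/! n)  ≡⟨ ½-*-double (σns (P n)) (1/! n) ⟩
  fromℕ (σns (P n)) * 1/! n              ∎)
  where
  open ≡-Reasoning
  n = suc m
  central≡2σ : (n ℕ.+ n) C n ≡ 2 ℕ.* σns (P n)
  central≡2σ = trans (centralC-suc m) (cong (2 ℕ.*_) (sym (σnsᵢ-path n m)))
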